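{- Let $c$, $\prec$ and $T'$ be as in the context. For $n\in\mathbb{N}$ and $p\colon\mathbb{N}\to\mathbb{N}$ there exists $i\leq 2^n$ such that for all $s\in\mathbb{B}^n$, $T'(s,p^{i+1}(0))\to T'(s,p^i(0))$ (where $p^i$ is the $i$-fold iterate of $p$). Moreover, letting $\delta_n p=p^i(0)$ for the least such $i$, we have for all $n$ and $p$: \[ \forall s\in\mathbb{B}^n\ \bigl(T'(s,p(\delta_n p))\to T'(s,\delta_n p)\bigr). \]
   Context: $\mathbb{B}=\{0,1\}$; $c\colon\mathbb{N}^2\to\mathbb{B}$ with $c(i,j)=c(j,i)$. The Erdős–Rado order $\prec$: $0\prec1$, and, given $\prec$ already defined on $\{0,\dots,j\}$, for $j<i$ set $j\prec i$ iff $c(k,i)=c(k,j)$ for all $k\prec j$. For a finite binary sequence $s$ of length $|s|$ with entries $s_0,\dots,s_{|s|-1}$ and $k\in\mathbb{N}$: $T'(s,k):\equiv\exists k'\in[|s|,k]\ \forall i<|s|\,(s_i=0\leftrightarrow i\prec k')$. -}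

module Defs where

open import Data.Nat using (ℕ; zero; suc; _≤_; _<ᵇ_)
open import Data.Bool using (Bool; true; false; _∧_; _∨_; not)
open import Data.Fin using (Fin; toℕ)
open import Data.Vec using (Vec; lookup)
open import Data.Product using (Σ; _×_)
open import Relation.Binary.PropositionalEquality using (_≡_)
open import Function.Bundles using (_⇔_)

-- Colourings c : ℕ² → 𝔹 (symmetry is a separate hypothesis in the theorem).
Colouring : Set
Colouring = ℕ → ℕ → Bool

_==ᵇ_ : Bool → Bool → Bool
false ==ᵇ false = true
true  ==ᵇ true  = true
_     ==ᵇ _     = false

allBelow : ℕ → (ℕ → Bool) → Bool
allBelow zero    f = true
allBelow (suc n) f = allBelow n f ∧ f n

-- The recursive call precF f k j only occurs with k < j, so fuel suc j suffices.
precF : Colouring → ℕ → ℕ → ℕ → Bool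
precF c zero    j i = false
precF c (suc f) j i =
  (j <ᵇ i) ∧ allBelow j (λ k → not (precF c f k j) ∨ (c k i ==ᵇ c k j))

prec : Colouring → ℕ → ℕ → Bool
prec c j i = precF c (suc j) j i

-- T'(s,k) :≡ ∃ k' ∈ [|s|, k] ∀ i < |s| (s_i = 0 ↔ i ≺ k').   (0 is false.)
T′ : Colouring → {n : ℕ} → Vec Bool n → ℕ → Set
T′ c {n} s k = Σ ℕ λ k′ → n ≤ k′ × k′ ≤ k ×
  ((i : Fin n) → (lookup s i ≡ false) ⇔ (prec c (toℕ i) k′ ≡ true))

iter : (ℕ → ℕ) → ℕ → ℕ → ℕ
iter p zero    x = x
iter p (suc i) x = p (iter p i x)

Good : Colouring → ℕ → (ℕ → ℕ) → ℕ → Set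
Good c n p i = (s : Vec Bool n) → T′ c s (iter p (suc i) 0) → T′ c s (iter p i 0)

-- Let x i = p^i(0) and let Tᵢ ⊆ 𝔹ⁿ be the set of s with T'(s, x i).  T'(s,k) is
-- monotone in k, so consecutive sets Tᵢ, Tᵢ₊₁ are always comparable under inclusion.
-- As long as Tᵢ₊₁ ⊆ Tᵢ fails, the sets must therefore grow strictly, which can
-- happen at most 2ⁿ times in a row.  Everything in sight is decidable, so the
-- least i with Tᵢ₊₁ ⊆ Tᵢ can be found by bounded search.
module Submission where

open import Defs
open import Level using (Level)
open import Data.Nat using (ℕ; zero; suc; _+_; _^_; _≤_; _<_; _≤?_; z≤n; s≤s)
open import Data.Nat.Properties
open import Data.Bool using (Bool; true; false)
open import Data.Bool.Properties using () renaming (_≟_ to _≟ᵇ_)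
open import Data.Vec using (Vec; []; _∷_; lookup)
open import Data.Fin using (toℕ)
open import Data.Fin.Properties using (all?)
open import Data.Product using (Σ; _×_; _,_)
open import Data.Sum using (_⊎_; inj₁; inj₂)
open import Function using (_∘_)
open import Function.Bundles using (_⇔_; mk⇔; module Equivalence)
open import Relation.Binary.PropositionalEquality using (_≡_; refl)
open import Relation.Nullary using (¬_; Dec; yes; no; contradiction)
open import Relation.Nullary.Decidable using (map′; _×-dec_; _→-dec_)
open import Relation.Unary using (Pred; Decidable; _⊆′_; _⊂′_)

private
  variable
    ℓ : Level
    n : ℕ

_⇔-dec_ : {A B : Set ℓ} → Dec A → Dec B → Dec (A ⇔ B)
a? ⇔-dec b? =
  map′ (λ (f , g) → mk⇔ f g) (λ e → to e , from e) ((a? →-dec b?) ×-dec (b? →-dec a?))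
  where open Equivalence

least? : {P : Pred ℕ ℓ} → Decidable P → ∀ m →
  (Σ ℕ λ i → i < m × P i × (∀ j → j < i → ¬ P j)) ⊎ (∀ j → j < m → ¬ P j)
least? P? zero = inj₂ λ _ ()
least? {P = P} P? (suc m) with least? P? m
... | inj₁ (i , i<m , Pi , minimal) = inj₁ (i , m<n⇒m<1+n i<m , Pi , minimal)
... | inj₂ none with P? m
...   | yes Pm = inj₁ (m , ≤-refl , Pm , none)
...   | no ¬Pm = inj₂ none≤m
  where
  none≤m : ∀ j → j < suc m → ¬ P j
  none≤m j j<1+m with m<1+n⇒m<n∨m≡n j<1+m
  ... | inj₁ j<m  = none j j<m
  ... | inj₂ refl = ¬Pm

∀-Vec? : {P : Pred (Vec Bool n) ℓ} → Decidable P → Dec (∀ s → P s)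
∀-Vec? {zero} P? with P? []
... | yes P[] = yes λ { [] → P[] }
... | no ¬P[] = no λ ∀P → ¬P[] (∀P [])
∀-Vec? {suc n} P? with ∀-Vec? (P? ∘ (false ∷_)) | ∀-Vec? (P? ∘ (true ∷_))
... | yes ∀P₀ | yes ∀P₁ = yes λ { (false ∷ s) → ∀P₀ s ; (true ∷ s) → ∀P₁ s }
... | no ¬∀P₀ | _       = no λ ∀P → ¬∀P₀ (∀P ∘ (false ∷_))
... | yes _   | no ¬∀P₁ = no λ ∀P → ¬∀P₁ (∀P ∘ (true ∷_))

⊆′? : {P Q : Pred (Vec Bool n) ℓ} → Decidable P → Decidable Q → Dec (P ⊆′ Q)
⊆′? P? Q? = ∀-Vec? λ s → P? s →-dec Q? s

count : {P : Pred (Vec Bool n) ℓ} → Decidable P → ℕ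
count {zero} P? with P? []
... | yes _ = 1
... | no _  = 0
count {suc n} P? = count (P? ∘ (false ∷_)) + count (P? ∘ (true ∷_))

count≤2^n : {P : Pred (Vec Bool n) ℓ} (P? : Decidable P) → count P? ≤ 2 ^ n
count≤2^n {zero} P? with P? []
... | yes _ = ≤-refl
... | no _  = z≤n
count≤2^n {suc n} P? rewrite +-identityʳ (2 ^ n) =
  +-mono-≤ (count≤2^n (P? ∘ (false ∷_))) (count≤2^n (P? ∘ (true ∷_)))

count-mono : {P Q : Pred (Vec Bool n) ℓ} (P? : Decidable P) (Q? : Decidable Q) →
  P ⊆′ Q → count P? ≤ count Q?
count-mono {zero} P? Q? P⊆Q with P? [] | Q? []
... | yes _   | yes _   = ≤-refl
... | yes P[] | no ¬Q[] = contradiction (P⊆Q [] P[]) ¬Q[]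
... | no _    | _       = z≤n
count-mono {suc n} P? Q? P⊆Q =
  +-mono-≤ (count-mono (P? ∘ (false ∷_)) (Q? ∘ (false ∷_)) (P⊆Q ∘ (false ∷_)))
           (count-mono (P? ∘ (true ∷_)) (Q? ∘ (true ∷_)) (P⊆Q ∘ (true ∷_)))

count-≥⇒⊇ : {P Q : Pred (Vec Bool n) ℓ} (P? : Decidable P) (Q? : Decidable Q) →
  P ⊆′ Q → count Q? ≤ count P? → Q ⊆′ P
count-≥⇒⊇ {zero} P? Q? P⊆Q Q≤P [] Q[] with P? [] | Q? []
... | yes P[] | _       = P[]
... | no _    | yes _   = contradiction Q≤P λ ()
... | no _    | no ¬Q[] = contradiction Q[] ¬Q[]
-- Both halves are monotone, so the inequality between the totals forces it on each half.
count-≥⇒⊇ {suc n} P? Q? P⊆Q Q≤P (false ∷ s) =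
  count-≥⇒⊇ (P? ∘ (false ∷_)) (Q? ∘ (false ∷_)) (P⊆Q ∘ (false ∷_))
    (+-cancelʳ-≤ _ _ _ (≤-trans Q≤P (+-monoʳ-≤ _
      (count-mono (P? ∘ (true ∷_)) (Q? ∘ (true ∷_)) (P⊆Q ∘ (true ∷_)))))) s
count-≥⇒⊇ {suc n} P? Q? P⊆Q Q≤P (true ∷ s) =
  count-≥⇒⊇ (P? ∘ (true ∷_)) (Q? ∘ (true ∷_)) (P⊆Q ∘ (true ∷_))
    (+-cancelˡ-≤ _ _ _ (≤-trans Q≤P (+-monoˡ-≤ _
      (count-mono (P? ∘ (false ∷_)) (Q? ∘ (false ∷_)) (P⊆Q ∘ (false ∷_)))))) s

count-strictMono : {P Q : Pred (Vec Bool n) ℓ} (P? : Decidable P) (Q? : Decidable Q) →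
  P ⊂′ Q → count P? < count Q?
count-strictMono P? Q? (P⊆Q , Q⊈P) with count Q? ≤? count P?
... | yes Q≤P = contradiction (count-≥⇒⊇ P? Q? P⊆Q Q≤P) Q⊈P
... | no Q≰P  = ≰⇒> Q≰P

module _ {Q : ℕ → Pred (Vec Bool n) ℓ} (Q? : ∀ i → Decidable (Q i))
         (comparable : ∀ i → Q (suc i) ⊆′ Q i ⊎ Q i ⊆′ Q (suc i)) where

  grows-unless-shrinks : ∀ i → ¬ Q (suc i) ⊆′ Q i → Q i ⊂′ Q (suc i)
  grows-unless-shrinks i ¬shrinks with comparable i
  ... | inj₁ shrinks = contradiction shrinks ¬shrinks
  ... | inj₂ grows   = grows , ¬shrinks

  growing⇒≤count : ∀ m → (∀ j → j < m → ¬ Q (suc j) ⊆′ Q j) → m ≤ count (Q? m)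
  growing⇒≤count zero    _       = z≤n
  growing⇒≤count (suc m) growing =
    ≤-<-trans (growing⇒≤count m λ j → growing j ∘ m<n⇒m<1+n)
              (count-strictMono (Q? m) (Q? (suc m)) (grows-unless-shrinks m (growing m ≤-refl)))

  first-shrink : Σ ℕ λ i → i ≤ 2 ^ n × Q (suc i) ⊆′ Q i × (∀ j → j < i → ¬ Q (suc j) ⊆′ Q j)
  first-shrink with least? (λ i → ⊆′? (Q? (suc i)) (Q? i)) (suc (2 ^ n))
  ... | inj₁ (i , i<1+2^n , shrinks , minimal) = i , m<1+n⇒m≤n i<1+2^n , shrinks , minimal
  ... | inj₂ growing =
    contradiction (≤-trans (growing⇒≤count _ growing) (count≤2^n (Q? _))) 1+n≰n

T′? : (c : Colouring) (s : Vec Bool n) (k : ℕ) → Dec (T′ c s k)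
T′? {n} c s k = map′
  (λ (k′ , k′<1+k , n≤k′ , colours) → k′ , n≤k′ , m<1+n⇒m≤n k′<1+k , colours)
  (λ (k′ , n≤k′ , k′≤k , colours) → k′ , s≤s k′≤k , n≤k′ , colours)
  (anyUpTo? (λ k′ → n ≤? k′ ×-dec all? λ i →
               (lookup s i ≟ᵇ false) ⇔-dec (prec c (toℕ i) k′ ≟ᵇ true))
            (suc k))

T′-mono : (c : Colouring) (s : Vec Bool n) {k l : ℕ} → k ≤ l → T′ c s k → T′ c s l
T′-mono c s k≤l (k′ , n≤k′ , k′≤k , colours) = k′ , n≤k′ , ≤-trans k′≤k k≤l , colours

T′-comparable : (c : Colouring) (k l : ℕ) →
  (λ (s : Vec Bool n) → T′ c s k) ⊆′ (λ s → T′ c s l) ⊎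
  (λ (s : Vec Bool n) → T′ c s l) ⊆′ (λ s → T′ c s k)
T′-comparable c k l with ≤-total k l
... | inj₁ k≤l = inj₁ λ s → T′-mono c s k≤l
... | inj₂ l≤k = inj₂ λ s → T′-mono c s l≤k

-- The counting argument uses no property of c.
lemma4p6 : (c : Colouring) → (∀ i j → c i j ≡ c j i) → (n : ℕ) → (p : ℕ → ℕ) →
    Σ ℕ λ i → i ≤ 2 ^ n × Good c n p i × (∀ j → j < i → ¬ Good c n p j) ×
    ((s : Vec Bool n) → T′ c s (p (iter p i 0)) → T′ c s (iter p i 0))
lemma4p6 c _ n p =
  let i , i≤2^n , shrinks , minimal =
        first-shrink (λ i s → T′? c s (iter p i 0)) (λ i → T′-comparable {n} c _ _)
  in  i , i≤2^n , shrinks , minimal , shrinks
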